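{- Let $\mathcal{U}=(V,E,F,s,\Sigma)$ be the union automaton of two Wheeler automata, let $P_0,\dots,P_k$ be a W-consistent partition of $V$, and let $v,v'\in P_h$ with $v\ne v'$ and $\lambda(v)=\lambda(v')$. Let $\ell$ (resp. $\ell'$) be the smallest index such that some edge goes from a node of $P_\ell$ to $v$ (resp. from $P_{\ell'}$ to $v'$), and $m$ (resp. $m'$) the largest index such that some edge goes from a node of $P_m$ to $v$ (resp. from $P_{m'}$ to $v'$). If it is not the case that $\ell=m=\ell'=m'$, then in every Wheeler C-order of $\mathcal{U}$: $m\le\ell'$ implies $v<v'$, and $m'\le\ell$ implies $v>v'$. Moreover, if neither $m\le\ell'$ nor $m'\le\ell$ holds, then $\mathcal{U}$ has no Wheeler C-order.
   Context: Wheeler graph: a directed edge-labeled graph with a node ordering such that in-degree-$0$ nodes come first and for edges $(u,v)$ labeled $a$, $(u',v')$ labeled $a'$: $a<a'\Rightarrow v<v'$ and $(a=a')\wedge(u<u')\Rightarrow v\le v'$. NFA $(V,E,F,s,\Sigma)$ with $E\subseteq V\times V\times\Sigma$, $s$ the only state of in-degree $0$, all states reachable from $s$ and able to reach a final state. Wheeler automaton: NFA without $\epsilon$-transitions with a fixed state ordering making its state diagram a Wheeler graph. For Wheeler automata $\mathcal{A}_b=(V_b,E_b,F_b,s_b,\Sigma)$, $b=0,1$, with disjoint state sets, the union automaton has $V=(V_0\setminus\{s_0\})\cup(V_1\setminus\{s_1\})\cup\{s\}$, $E=E_0^*\cup E_1^*$ ($E_b$ with edges leaving $s_b$ redirected to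 leave $s$), $F=(F_0\setminus\{s_0\})\cup(F_1\setminus\{s_1\})$ plus $s$ if $s_0\in F_0$ or $s_1\in F_1$. A Wheeler C-order of $\mathcal{U}$ is an ordering of $V$ making $\mathcal{U}$ a Wheeler graph and preserving the given relative orders of $V_0\setminus\{s_0\}$ and $V_1\setminus\{s_1\}$. For $v\ne s$, $\lambda(v)$ is the label of the edges entering $v$. An ordered partition $P_0,\dots,P_k$ of $V$ is W-consistent if $x\in P_i$, $y\in P_j$, $i<j$ implies $x<y$ in every Wheeler C-order of $\mathcal{U}$. -}

module Defs where

open import Data.Nat as ℕ using (ℕ)
open import Data.Fin as Fin using (Fin; zero; suc)
open import Data.Bool using (Bool; true)
open import Data.Product using (Σ; ∃; ∃-syntax; _×_; _,_)
open import Data.Sum using (_⊎_)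
open import Data.List using (List)
open import Data.List.Membership.Propositional using (_∈_)
open import Relation.Nullary using (¬_)
open import Relation.Binary.PropositionalEquality using (_≡_; _≢_)
open import Relation.Binary.Construct.Closure.ReflexiveTransitive using (Star)
open import Function.Definitions using (Injective)

-- Alphabet Σ: labels are natural numbers with their usual total order.

-- A labelled edge relation on a node type V:  E u v a  means an edge u → v labelled a.
EdgeRel : Set → Set₁
EdgeRel V = V → V → ℕ → Set

InDeg0 : {V : Set} → EdgeRel V → V → Set
InDeg0 {V} E x = (u : V) (a : ℕ) → ¬ E u x a

-- Wheeler graph w.r.t. a strict order _<_ on nodes (≤ means < or =).
IsWheeler : {V : Set} → EdgeRel V → (V → V → Set) → Set
IsWheeler {V} E _<_ =
    ((x y : V) → InDeg0 E x → ¬ InDeg0 E y → x < y)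
  × ((u v u' v' : V) (a a' : ℕ) → E u v a → E u' v' a' → a ℕ.< a' → v < v')
  × ((u v u' v' : V) (a : ℕ) → E u v a → E u' v' a → u < u' → (v < v' ⊎ v ≡ v'))

-- A Wheeler automaton: states Fin (suc n) ordered by the natural order of Fin,
-- start state s = zero, finitely many edges given as a list of (source, target, label).
record WheelerAutomaton : Set₁ where
  field
    n      : ℕ
    edges  : List (Fin (ℕ.suc n) × Fin (ℕ.suc n) × ℕ)
    final  : Fin (ℕ.suc n) → Bool
  Edge : EdgeRel (Fin (ℕ.suc n))
  Edge u v a = (u , v , a) ∈ edges
  Step : Fin (ℕ.suc n) → Fin (ℕ.suc n) → Set
  Step u v = ∃[ a ] Edge u v a
  field
    start-indeg0  : InDeg0 Edge zero
    only-indeg0   : (v : Fin (ℕ.suc n)) → v ≢ zero → ¬ InDeg0 Edge v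
    reachable     : (v : Fin (ℕ.suc n)) → Star Step zero v
    coreachable   : (v : Fin (ℕ.suc n)) → ∃[ f ] (final f ≡ true × Star Step v f)
    wheeler       : IsWheeler Edge Fin._<_

module Union (A₀ A₁ : WheelerAutomaton) where
  private
    module A₀ = WheelerAutomaton A₀
    module A₁ = WheelerAutomaton A₁

  -- V = (V₀ ∖ {s₀}) ∪ (V₁ ∖ {s₁}) ∪ {s}   (disjoint union)
  data State : Set where
    s   : State
    inl : Fin A₀.n → State
    inr : Fin A₁.n → State

  emb₀ : Fin (ℕ.suc A₀.n) → State
  emb₀ zero    = s
  emb₀ (suc i) = inl i

  emb₁ : Fin (ℕ.suc A₁.n) → State
  emb₁ zero    = s
  emb₁ (suc i) = inr i

  -- E = E₀* ∪ E₁*  (edges leaving s_b redirected to leave s)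
  UEdge : EdgeRel State
  UEdge x y a =
      (∃[ u ] ∃[ v ] (A₀.Edge u v a × emb₀ u ≡ x × emb₀ v ≡ y))
    ⊎ (∃[ u ] ∃[ v ] (A₁.Edge u v a × emb₁ u ≡ x × emb₁ v ≡ y))

  -- F (not needed for the statement, included for completeness)
  UFinal : State → Set
  UFinal s       = A₀.final zero ≡ true ⊎ A₁.final zero ≡ true
  UFinal (inl i) = A₀.final (suc i) ≡ true
  UFinal (inr i) = A₁.final (suc i) ≡ true

  -- A linear order on V, given by an injective rank; x < y iff rank x < rank y.
  -- Wheeler C-order: makes U a Wheeler graph and preserves the orders of V₀∖{s₀}, V₁∖{s₁}.
  record COrder : Set where
    field
      rank       : State → ℕ
      rank-inj   : Injective _≡_ _≡_ rank
      is-wheeler : IsWheeler UEdge (λ x y → rank x ℕ.< rank y)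
      pres₀      : (i j : Fin A₀.n) → i Fin.< j → rank (inl i) ℕ.< rank (inl j)
      pres₁      : (i j : Fin A₁.n) → i Fin.< j → rank (inr i) ℕ.< rank (inr j)

  -- Ordered partition P₀,…,P_k of V, given by the block index of each state;
  -- blocks are nonempty (surjectivity).
  IsOrderedPartition : (k : ℕ) → (State → Fin (ℕ.suc k)) → Set
  IsOrderedPartition k p = (i : Fin (ℕ.suc k)) → ∃[ x ] p x ≡ i

  WConsistent : (k : ℕ) → (State → Fin (ℕ.suc k)) → Set
  WConsistent k p = (x y : State) → p x Fin.< p y →
    (C : COrder) → COrder.rank C x ℕ.< COrder.rank C y

  -- λ(v) = a : v has an entering edge, and all entering edges are labelled a.
  HasLabel : State → ℕ → Set
  HasLabel v a = (∃[ u ] UEdge u v a) × ((u : State) (b : ℕ) → UEdge u v b → b ≡ a)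

  IsMinSrc : {k : ℕ} → (State → Fin (ℕ.suc k)) → State → Fin (ℕ.suc k) → Set
  IsMinSrc p v ℓ = (∃[ u ] ∃[ a ] (UEdge u v a × p u ≡ ℓ))
                 × ((u : State) (a : ℕ) → UEdge u v a → ℓ Fin.≤ p u)

  IsMaxSrc : {k : ℕ} → (State → Fin (ℕ.suc k)) → State → Fin (ℕ.suc k) → Set
  IsMaxSrc p v m = (∃[ u ] ∃[ a ] (UEdge u v a × p u ≡ m))
                 × ((u : State) (a : ℕ) → UEdge u v a → p u Fin.≤ m)

module Submission where

open import Defs
open import Data.Nat as ℕ using (ℕ)
open import Data.Fin as Fin using (Fin)
open import Data.Product using (_×_; _,_; proj₂)
open import Data.Sum using (inj₁; inj₂)
open import Level using (Level)
open import Relation.Nullary using (¬_; contradiction)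
open import Relation.Binary.Bundles using (Poset)
open import Relation.Binary.PropositionalEquality using (_≡_; _≢_; refl; sym; subst₂)
import Data.Fin.Properties as Finₚ
import Data.Nat.Properties as ℕₚ

-- W-consistency orders sources in different blocks, and the Wheeler axiom
-- for equal labels transports this order to the targets.  From ℓ ≤ m ≤ ℓ' ≤ m'
-- with not all four equal we get ℓ < m', so a source of v lies in a strictly
-- earlier block than a source of v', forcing v < v'.  If both m ≰ ℓ' and m' ≰ ℓ,
-- the same argument forces v < v' and v' < v at once.

module _ {o ℓ₁ ℓ₂ : Level} (P : Poset o ℓ₁ ℓ₂) where
  open Poset P

  chain-collapse : ∀ {a b c d} → a ≤ b → b ≤ c → c ≤ d → a ≈ d →
                   a ≈ b × b ≈ c × c ≈ d
  chain-collapse {a} {b} {c} {d} a≤b b≤c c≤d a≈d =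
    antisym a≤b b≤a , antisym b≤c c≤b , antisym c≤d d≤c
    where
      d≤a : d ≤ a
      d≤a = reflexive (Eq.sym a≈d)
      b≤a : b ≤ a
      b≤a = trans b≤c (trans c≤d d≤a)
      c≤b : c ≤ b
      c≤b = trans c≤d (trans d≤a a≤b)
      d≤c : d ≤ c
      d≤c = trans d≤a (trans a≤b b≤c)

chain-< : ∀ {n} {a b c d : Fin n} → a Fin.≤ b → b Fin.≤ c → c Fin.≤ d →
          ¬ (a ≡ b × b ≡ c × c ≡ d) → a Fin.< d
chain-< {n} a≤b b≤c c≤d not-all-equal =
  Finₚ.≤∧≢⇒< (Finₚ.≤-trans a≤b (Finₚ.≤-trans b≤c c≤d))
    (λ a≡d → not-all-equal (chain-collapse (Finₚ.≤-poset n) a≤b b≤c c≤d a≡d))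

module _ {V : Set} {E : EdgeRel V} {_<_ : V → V → Set} (wheeler : IsWheeler E _<_) where

  same-label-targets-< : ∀ {u v u' v' a} → E u v a → E u' v' a → u < u' → v ≢ v' → v < v'
  same-label-targets-< {u} {v} {u'} {v'} {a} e e' u<u' v≢v'
    with proj₂ (proj₂ wheeler) u v u' v' a e e' u<u'
  ... | inj₁ v<v' = v<v'
  ... | inj₂ v≡v' = contradiction v≡v' v≢v'

module _ (A₀ A₁ : WheelerAutomaton) where
  open Union A₀ A₁

  module _ {k : ℕ} {p : State → Fin (ℕ.suc k)} where

    minSrc≤maxSrc : ∀ {v ℓ m} → IsMinSrc p v ℓ → IsMaxSrc p v m → ℓ Fin.≤ m
    minSrc≤maxSrc (_ , ℓ≤) ((u , b , e , pu≡m) , _) = subst₂ Fin._≤_ refl pu≡m (ℓ≤ u b e)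

    module _ (wc : WConsistent k p) {v v' : State} (v≢v' : v ≢ v') {a : ℕ}
             (λv≡a : HasLabel v a) (λv'≡a : HasLabel v' a) where

      earlier-source⇒rank< : ∀ {x y b b'} → UEdge x v b → UEdge y v' b' → p x Fin.< p y →
                              (C : COrder) → COrder.rank C v ℕ.< COrder.rank C v'
      earlier-source⇒rank< {x} {y} {b} {b'} e e' px<py C
        with proj₂ λv≡a x b e | proj₂ λv'≡a y b' e'
      ... | refl | refl =
        same-label-targets-< (COrder.is-wheeler C) e e' (wc x y px<py C) v≢v'

      minSrc<maxSrc⇒rank< : ∀ {ℓ m'} → IsMinSrc p v ℓ → IsMaxSrc p v' m' → ℓ Fin.< m' →
                             (C : COrder) → COrder.rank C v ℕ.< COrder.rank C v'
      minSrc<maxSrc⇒rank< ((x , b , e , px≡ℓ) , _) ((y , b' , e' , py≡m') , _) ℓ<m' =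
        earlier-source⇒rank< e e' (subst₂ Fin._<_ (sym px≡ℓ) (sym py≡m') ℓ<m')

lemma7 : (A₀ A₁ : WheelerAutomaton) →
    let open Union A₀ A₁ in
    (k : ℕ) (p : State → Fin (ℕ.suc k)) →
    IsOrderedPartition k p → WConsistent k p →
    (v v' : State) → p v ≡ p v' → v ≢ v' →
    (a : ℕ) → HasLabel v a → HasLabel v' a →
    (ℓ m ℓ' m' : Fin (ℕ.suc k)) →
    IsMinSrc p v ℓ → IsMaxSrc p v m → IsMinSrc p v' ℓ' → IsMaxSrc p v' m' →
    ¬ (ℓ ≡ m × m ≡ ℓ' × ℓ' ≡ m') →
    ((C : COrder) →
        (m Fin.≤ ℓ' → COrder.rank C v ℕ.< COrder.rank C v')
      × (m' Fin.≤ ℓ → COrder.rank C v' ℕ.< COrder.rank C v))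
    × (¬ m Fin.≤ ℓ' → ¬ m' Fin.≤ ℓ → ¬ COrder)
lemma7 A₀ A₁ k p _ wc v v' _ v≢v' _ λv λv' ℓ m ℓ' m' minv maxv minv' maxv' not-all-equal =
  (λ C → (λ m≤ℓ' → v<v' (ℓ<m' m≤ℓ') C) , (λ m'≤ℓ → v'<v (ℓ'<m m'≤ℓ) C))
  , λ m≰ℓ' m'≰ℓ C → ℕₚ.<-asym (v<v' (ℕₚ.≰⇒> m'≰ℓ) C) (v'<v (ℕₚ.≰⇒> m≰ℓ') C)
  where
    open Union A₀ A₁

    v<v' : ℓ Fin.< m' → (C : COrder) → COrder.rank C v ℕ.< COrder.rank C v'
    v<v' = minSrc<maxSrc⇒rank< A₀ A₁ wc v≢v' λv λv' minv maxv'

    v'<v : ℓ' Fin.< m → (C : COrder) → COrder.rank C v' ℕ.< COrder.rank C v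
    v'<v = minSrc<maxSrc⇒rank< A₀ A₁ wc (λ v'≡v → v≢v' (sym v'≡v)) λv' λv minv' maxv

    ℓ≤m : ℓ Fin.≤ m
    ℓ≤m = minSrc≤maxSrc A₀ A₁ minv maxv

    ℓ'≤m' : ℓ' Fin.≤ m'
    ℓ'≤m' = minSrc≤maxSrc A₀ A₁ minv' maxv'

    ℓ<m' : m Fin.≤ ℓ' → ℓ Fin.< m'
    ℓ<m' m≤ℓ' = chain-< ℓ≤m m≤ℓ' ℓ'≤m' not-all-equal

    ℓ'<m : m' Fin.≤ ℓ → ℓ' Fin.< m
    ℓ'<m m'≤ℓ = chain-< ℓ'≤m' m'≤ℓ ℓ≤m
      (λ { (refl , refl , refl) → not-all-equal (refl , refl , refl) })
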